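{- Let $\mathbb{F}_q$ be a finite field, $a,b\in\mathbb{F}_q$ with $b\neq0$, and $Q=\begin{pmatrix} a & b\\ 1 & 0\end{pmatrix}$, and suppose $x^2-ax-b$ has distinct roots in $\mathbb{F}_q$. If all non-trivial orbits of $G=\langle Q\rangle$ acting on $\mathbb{F}_q\times\mathbb{F}_q$ have equal length $l$, or the non-trivial orbits have exactly two different lengths $l$ and $kl$, then the total number of non-trivial orbits is at least $q+1$.
   Context: $G=\langle Q\rangle$ acts on $\mathbb{F}_q\times\mathbb{F}_q$ (column vectors) by $v\mapsto Q^nv$; orbit length is the number of elements of the orbit; non-trivial orbits are orbits of non-zero vectors. -}

module Defs where

open import Level using (0ℓ)
open import Data.Nat using (ℕ; zero; suc) renaming (_*_ to _*ℕ_)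
open import Data.Product using (_×_; _,_; Σ; ∃; ∃-syntax)
open import Data.List using (List; length)
open import Data.List.Membership.Propositional using (_∈_)
open import Data.List.Relation.Unary.Unique.Propositional using (Unique)
open import Data.List.Relation.Unary.AllPairs using (AllPairs)
open import Relation.Binary.PropositionalEquality using (_≡_)
open import Relation.Nullary using (¬_)
import Data.Sum
open import Algebra.Structures using (IsCommutativeRing)

record FiniteField : Set₁ where
  infixl 6 _+_ _-_
  infixl 7 _*_
  field
    Carrier : Set
    _+_ _*_ : Carrier → Carrier → Carrier
    -_      : Carrier → Carrier
    0# 1#   : Carrier
    isCommutativeRing : IsCommutativeRing _≡_ _+_ _*_ -_ 0# 1#
    0≢1     : ¬ (0# ≡ 1#)
    inverse : ∀ x → ¬ (x ≡ 0#) → ∃[ y ] (x * y ≡ 1#)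
    elements : List Carrier
    complete : ∀ x → x ∈ elements
    unique   : Unique elements

  _-_ : Carrier → Carrier → Carrier
  x - y = x + (- y)

  size : ℕ
  size = length elements

module _ (F : FiniteField) where
  open FiniteField F

  Vec2 : Set
  Vec2 = Carrier × Carrier

  zeroV : Vec2
  zeroV = (0# , 0#)

  -- multiplication by Q = [[a , b] , [1 , 0]] :  (x , y) ↦ (a x + b y , x)
  applyQ : Carrier → Carrier → Vec2 → Vec2
  applyQ a b (x , y) = (a * x + b * y , x)

  powQ : Carrier → Carrier → ℕ → Vec2 → Vec2
  powQ a b zero    v = v
  powQ a b (suc n) v = applyQ a b (powQ a b n v)

  InOrbit : Carrier → Carrier → Vec2 → Vec2 → Set
  InOrbit a b v w = ∃[ n ] (powQ a b n v ≡ w)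

  OrbitLength : Carrier → Carrier → Vec2 → ℕ → Set
  OrbitLength a b v l =
    Σ (List Vec2) λ ws → Unique ws × length ws ≡ l
      × (∀ w → w ∈ ws → InOrbit a b v w)
      × (∀ w → InOrbit a b v w → w ∈ ws)

  -- reps is a complete list of representatives of the non-trivial orbits,
  -- one per orbit; its length is the number of non-trivial orbits
  NontrivialOrbitReps : Carrier → Carrier → List Vec2 → Set
  NontrivialOrbitReps a b reps =
    (∀ v → v ∈ reps → ¬ (v ≡ zeroV))
    × AllPairs (λ v w → ¬ InOrbit a b v w) reps
    × (∀ w → ¬ (w ≡ zeroV) → ∃[ v ] (v ∈ reps × InOrbit a b v w))

  DistinctRoots : Carrier → Carrier → Set
  DistinctRoots a b = ∃[ r ] ∃[ s ] (¬ (r ≡ s)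
    × (r * r - a * r - b ≡ 0#) × (s * s - a * s - b ≡ 0#))

  AllOrbitsLength : Carrier → Carrier → ℕ → Set
  AllOrbitsLength a b l = ∀ v → ¬ (v ≡ zeroV) → OrbitLength a b v l

  TwoOrbitLengths : Carrier → Carrier → ℕ → ℕ → Set
  TwoOrbitLengths a b l k =
    ¬ (k *ℕ l ≡ l)
    × (∀ v → ¬ (v ≡ zeroV) → OrbitLength a b v l Data.Sum.⊎ OrbitLength a b v (k *ℕ l))
    × (∃[ v ] (¬ (v ≡ zeroV) × OrbitLength a b v l))
    × (∃[ v ] (¬ (v ≡ zeroV) × OrbitLength a b v (k *ℕ l)))

-- The roots r ≠ s of x² - a x - b are non-zero because b ≠ 0, and (r , 1), (s , 1) is an
-- eigenbasis of Q, so Fermat's little theorem r ^ (q - 1) = s ^ (q - 1) = 1 gives Q ^ (q - 1) = 1.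
-- Hence every orbit has at most q - 1 elements, and covering the q² - 1 non-zero vectors takes at
-- least (q² - 1) / (q - 1) = q + 1 orbits.
module Submission where

open import Defs
open import Data.Nat using (ℕ; _≤_; suc)
open import Data.Product using (_×_; ∃-syntax)
open import Data.Sum using (_⊎_)
open import Data.List using (List; length)
open import Relation.Binary.PropositionalEquality using (_≡_)
open import Relation.Nullary using (¬_)

open import Algebra.Bundles using (CommutativeRing)
import Algebra.Properties.CommutativeSemigroup as CommutativeSemigroupProperties
import Algebra.Properties.Group as GroupProperties
import Algebra.Properties.Ring as RingProperties
import Algebra.Properties.Semiring.Exp as SemiringExp
open import Data.Empty using (⊥-elim)
open import Data.Fin using (Fin; zero; suc)
open import Data.Fin.Properties using (injective⇒≤) renaming (_≟_ to _≟ᶠ_)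
open import Data.List
  using ([]; _∷_; lookup; filter; map; foldr; concatMap; cartesianProduct; applyUpTo)
open import Data.List.Membership.Propositional using (_∈_)
open import Data.List.Membership.Propositional.Properties
  using (∈-lookup; ∈-filter⁺; ∈-filter⁻; ∈-map⁺; ∈-map⁻; ∈-applyUpTo⁺; ∈-concatMap⁺; ∈-length)
open import Data.List.Membership.Propositional.Properties.WithK using (unique∧set⇒bag)
open import Data.List.Properties using (filter-all; length-map; length-++; length-applyUpTo)
open import Data.List.Relation.Binary.BagAndSetEquality using (∼bag⇒↭)
open import Data.List.Relation.Binary.Permutation.Propositional using (_↭_; ↭⇒↭ₛ)
open import Data.List.Relation.Binary.Permutation.Setoid.Properties using (foldr-commMonoid)
open import Data.List.Relation.Binary.Subset.Propositional using (_⊆_)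
open import Data.List.Relation.Unary.All as All using (All; []; _∷_)
open import Data.List.Relation.Unary.AllPairs using (_∷_)
open import Data.List.Relation.Unary.Any as Any using (here; there; index)
open import Data.List.Relation.Unary.Any.Properties using (lookup-index)
open import Data.List.Relation.Unary.Unique.Propositional using (Unique)
import Data.List.Relation.Unary.Unique.Propositional.Properties as Unique
open import Data.Nat using (zero; NonZero; >-nonZero; s≤s⁻¹) renaming (_*_ to _*ℕ_; _+_ to _+ℕ_)
open import Data.Nat.DivMod using (_%_; _/_; m≡m%n+[m/n]*n; m%n<n)
open import Data.Nat.Properties using (*-suc; *-cancelʳ-≤)
open import Data.Product using (_,_; proj₂)
open import Data.Product.Properties using (≡-dec)
open import Function.Base using (_∘_)
open import Function.Bundles using (mk⇔)
open import Relation.Binary.Definitions using (DecidableEquality)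
open import Relation.Binary.PropositionalEquality
  using (refl; sym; trans; cong; cong₂; subst; subst₂; setoid; module ≡-Reasoning)
open import Relation.Nullary using (yes; no; ¬?)
open import Relation.Nullary.Decidable using (map′)

module _ {A : Set} where

  lookup-injective : ∀ {xs : List A} → Unique xs → ∀ {i j} → lookup xs i ≡ lookup xs j → i ≡ j
  lookup-injective {_ ∷ _} _ {zero} {zero} _ = refl
  lookup-injective {_ ∷ xs} u {zero} {suc j} e =
    ⊥-elim (Unique.Unique[x∷xs]⇒x∉xs u (subst (_∈ xs) (sym e) (∈-lookup j)))
  lookup-injective {_ ∷ xs} u {suc i} {zero} e =
    ⊥-elim (Unique.Unique[x∷xs]⇒x∉xs u (subst (_∈ xs) e (∈-lookup i)))
  lookup-injective {_ ∷ _} (_ ∷ u) {suc i} {suc j} e = cong suc (lookup-injective u e)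

  Unique∧⊆⇒length≤ : ∀ {xs ys : List A} → Unique xs → xs ⊆ ys → length xs ≤ length ys
  Unique∧⊆⇒length≤ {xs} {ys} u xs⊆ys = injective⇒≤ position-injective
    where
    position : Fin (length xs) → Fin (length ys)
    position i = index (xs⊆ys (∈-lookup i))

    position-injective : ∀ {i j} → position i ≡ position j → i ≡ j
    position-injective {i} {j} e = lookup-injective u
      (trans (lookup-index (xs⊆ys (∈-lookup i)))
        (trans (cong (lookup ys) e) (sym (lookup-index (xs⊆ys (∈-lookup j))))))

  length-concatMap : ∀ {B : Set} (f : A → List B) {n} → (∀ x → length (f x) ≡ n) →
                     ∀ xs → length (concatMap f xs) ≡ length xs *ℕ n
  length-concatMap f |f|≡n []       = refl
  length-concatMap f |f|≡n (x ∷ xs) =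
    trans (length-++ (f x)) (cong₂ _+ℕ_ (|f|≡n x) (length-concatMap f |f|≡n xs))

  length-cartesianProduct : ∀ {B : Set} (xs : List A) (ys : List B) →
                            length (cartesianProduct xs ys) ≡ length xs *ℕ length ys
  length-cartesianProduct []       ys = refl
  length-cartesianProduct (x ∷ xs) ys =
    trans (length-++ (map (x ,_) ys)) (cong₂ _+ℕ_ (length-map (x ,_) ys) (length-cartesianProduct xs ys))

  module _ (_≟_ : DecidableEquality A) where

    length-filter-≢ : ∀ {xs : List A} {x} → Unique xs → x ∈ xs →
                      suc (length (filter (λ y → ¬? (y ≟ x)) xs)) ≡ length xs
    length-filter-≢ {y ∷ ys} {x} (y≢ys ∷ u) x∈xs with y ≟ x | x∈xs
    ... | yes refl | _          =
      cong (suc ∘ length) (filter-all (λ z → ¬? (z ≟ y)) (All.map (λ y≢z z≡y → y≢z (sym z≡y)) y≢ys))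
    ... | no y≢x   | here x≡y   = ⊥-elim (y≢x (sym x≡y))
    ... | no _     | there x∈ys = cong suc (length-filter-≢ u x∈ys)

q*q≤1+k*m⇒1+q≤k : ∀ {q m k} .{{_ : NonZero m}} → q ≡ suc m → q *ℕ q ≤ suc (k *ℕ m) → suc q ≤ k
q*q≤1+k*m⇒1+q≤k {m = m} {k} refl le =
  *-cancelʳ-≤ (suc (suc m)) k m (subst (_≤ k *ℕ m) (cong (m +ℕ_) (*-suc m m)) (s≤s⁻¹ le))

module FiniteFieldProperties (F : FiniteField) where
  open FiniteField F

  commutativeRing : CommutativeRing _ _
  commutativeRing = record { isCommutativeRing = isCommutativeRing }

  open CommutativeRing commutativeRing public
    using (+-comm; +-identityʳ; *-assoc; *-comm; *-identityˡ; *-identityʳ; zeroʳ;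
           distribˡ; +-group; ring; *-isCommutativeMonoid; *-commutativeSemigroup; +-commutativeSemigroup; semiring)
  open SemiringExp semiring public using (_^_)
  open GroupProperties +-group public using (x∙y⁻¹≈ε⇒x≈y; //-rightDividesˡ)
  open RingProperties ring public using ([y-z]x≈yx-zx; x[y-z]≈xy-xz)
  module * = CommutativeSemigroupProperties *-commutativeSemigroup
  module + = CommutativeSemigroupProperties +-commutativeSemigroup
  open ≡-Reasoning

  _≟_ : DecidableEquality Carrier
  x ≟ y = map′ index-injective (λ { refl → refl }) (index (complete x) ≟ᶠ index (complete y))
    where
    index-injective : index (complete x) ≡ index (complete y) → x ≡ y
    index-injective e = trans (lookup-index (complete x))
      (trans (cong (lookup elements) e) (sym (lookup-index (complete y))))

  *-cancelˡ-≢0 : ∀ {u x y} → ¬ (u ≡ 0#) → u * x ≡ u * y → x ≡ y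
  *-cancelˡ-≢0 {u} {x} {y} u≢0 e with inverse u u≢0
  ... | u⁻¹ , uu⁻¹≡1 = begin
    x              ≡⟨ sym (*-identityˡ x) ⟩
    1# * x         ≡⟨ cong (_* x) (trans (sym uu⁻¹≡1) (*-comm u u⁻¹)) ⟩
    (u⁻¹ * u) * x  ≡⟨ *-assoc u⁻¹ u x ⟩
    u⁻¹ * (u * x)  ≡⟨ cong (u⁻¹ *_) e ⟩
    u⁻¹ * (u * y)  ≡⟨ sym (*-assoc u⁻¹ u y) ⟩
    (u⁻¹ * u) * y  ≡⟨ cong (_* y) (trans (*-comm u⁻¹ u) uu⁻¹≡1) ⟩
    1# * y         ≡⟨ *-identityˡ y ⟩
    y              ∎

  *-≢0 : ∀ {u v} → ¬ (u ≡ 0#) → ¬ (v ≡ 0#) → ¬ (u * v ≡ 0#)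
  *-≢0 {u} u≢0 v≢0 uv≡0 = v≢0 (*-cancelˡ-≢0 u≢0 (trans uv≡0 (sym (zeroʳ u))))

  units : List Carrier
  units = filter (λ x → ¬? (x ≟ 0#)) elements

  ∈-units⁻ : ∀ {x} → x ∈ units → ¬ (x ≡ 0#)
  ∈-units⁻ = proj₂ ∘ ∈-filter⁻ (λ x → ¬? (x ≟ 0#)) {xs = elements}

  ∈-units⁺ : ∀ {x} → ¬ (x ≡ 0#) → x ∈ units
  ∈-units⁺ = ∈-filter⁺ (λ x → ¬? (x ≟ 0#)) (complete _)

  size≡1+|units| : size ≡ suc (length units)
  size≡1+|units| = sym (length-filter-≢ _≟_ unique (complete 0#))

  instance
    |units|-nonZero : NonZero (length units)
    |units|-nonZero = >-nonZero (∈-length (∈-units⁺ (0≢1 ∘ sym)))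

  product : List Carrier → Carrier
  product = foldr _*_ 1#

  product-↭ : ∀ {xs ys} → xs ↭ ys → product xs ≡ product ys
  product-↭ p = foldr-commMonoid (setoid Carrier) *-isCommutativeMonoid (↭⇒↭ₛ p)

  product-≢0 : ∀ {xs} → All (λ x → ¬ (x ≡ 0#)) xs → ¬ (product xs ≡ 0#)
  product-≢0 []           1≡0 = 0≢1 (sym 1≡0)
  product-≢0 (x≢0 ∷ xs≢0) = *-≢0 x≢0 (product-≢0 xs≢0)

  product-map-* : ∀ x xs → product (map (x *_) xs) ≡ x ^ length xs * product xs
  product-map-* x []       = sym (*-identityˡ 1#)
  product-map-* x (y ∷ ys) = begin
    (x * y) * product (map (x *_) ys)       ≡⟨ cong ((x * y) *_) (product-map-* x ys) ⟩
    (x * y) * (x ^ length ys * product ys)  ≡⟨ *.interchange x y (x ^ length ys) (product ys) ⟩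
    (x * x ^ length ys) * (y * product ys)  ∎

  map-*-units↭units : ∀ {x} → ¬ (x ≡ 0#) → map (x *_) units ↭ units
  map-*-units↭units {x} x≢0 = ∼bag⇒↭ (unique∧set⇒bag
    (Unique.map⁺ (*-cancelˡ-≢0 x≢0) (Unique.filter⁺ _ unique)) (Unique.filter⁺ _ unique)
    (mk⇔ to from))
    where
    to : ∀ {z} → z ∈ map (x *_) units → z ∈ units
    to z∈ with ∈-map⁻ (x *_) z∈
    ... | y , y∈units , refl = ∈-units⁺ (*-≢0 x≢0 (∈-units⁻ y∈units))

    from : ∀ {z} → z ∈ units → z ∈ map (x *_) units
    from {z} z∈units with inverse x x≢0
    ... | x⁻¹ , xx⁻¹≡1 = subst (_∈ map (x *_) units) x[x⁻¹z]≡z (∈-map⁺ (x *_) (∈-units⁺ x⁻¹z≢0))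
      where
      x[x⁻¹z]≡z : x * (x⁻¹ * z) ≡ z
      x[x⁻¹z]≡z = trans (sym (*-assoc x x⁻¹ z)) (trans (cong (_* z) xx⁻¹≡1) (*-identityˡ z))

      x⁻¹z≢0 : ¬ (x⁻¹ * z ≡ 0#)
      x⁻¹z≢0 e = ∈-units⁻ z∈units (trans (sym x[x⁻¹z]≡z) (trans (cong (x *_) e) (zeroʳ x)))

  -- Fermat: x · units is a permutation of units; compare the products and cancel.
  ^-|units|≡1 : ∀ {x} → ¬ (x ≡ 0#) → x ^ length units ≡ 1#
  ^-|units|≡1 {x} x≢0 = *-cancelˡ-≢0 (product-≢0 (All.tabulate ∈-units⁻)) (begin
    product units * x ^ length units  ≡⟨ *-comm (product units) _ ⟩
    x ^ length units * product units  ≡⟨ sym (product-map-* x units) ⟩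
    product (map (x *_) units)        ≡⟨ product-↭ (map-*-units↭units x≢0) ⟩
    product units                     ≡⟨ sym (*-identityʳ (product units)) ⟩
    product units * 1#                ∎)

module CompanionMatrix (F : FiniteField) (a b : FiniteField.Carrier F) where
  open FiniteField F
  open FiniteFieldProperties F
  open ≡-Reasoning

  infixr 7 Q·_ Q^_·_
  infixl 6 _⊕_

  Q·_ : Vec2 F → Vec2 F
  Q·_ = applyQ F a b

  Q^_·_ : ℕ → Vec2 F → Vec2 F
  Q^ n · v = powQ F a b n v

  _⊕_ : Vec2 F → Vec2 F → Vec2 F
  (x , y) ⊕ (x′ , y′) = (x + x′ , y + y′)

  Q·-homo-⊕ : ∀ u v → Q· (u ⊕ v) ≡ Q· u ⊕ Q· v
  Q·-homo-⊕ (x , y) (x′ , y′) = cong (_, x + x′) (begin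
    a * (x + x′) + b * (y + y′)          ≡⟨ cong₂ _+_ (distribˡ a x x′) (distribˡ b y y′) ⟩
    (a * x + a * x′) + (b * y + b * y′)  ≡⟨ +.interchange (a * x) (a * x′) (b * y) (b * y′) ⟩
    (a * x + b * y) + (a * x′ + b * y′)  ∎)

  Q^-homo-⊕ : ∀ n u v → Q^ n · (u ⊕ v) ≡ Q^ n · u ⊕ Q^ n · v
  Q^-homo-⊕ zero    u v = refl
  Q^-homo-⊕ (suc n) u v = trans (cong Q·_ (Q^-homo-⊕ n u v)) (Q·-homo-⊕ _ _)

  Q^-homo-+ : ∀ i j v → Q^ (i +ℕ j) · v ≡ Q^ i · Q^ j · v
  Q^-homo-+ zero    j v = refl
  Q^-homo-+ (suc i) j v = cong Q·_ (Q^-homo-+ i j v)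

  IsRoot : Carrier → Set
  IsRoot r = r * r ≡ b + a * r

  root⇒IsRoot : ∀ {r} → r * r - a * r - b ≡ 0# → IsRoot r
  root⇒IsRoot {r} e = begin
    r * r                    ≡⟨ sym (//-rightDividesˡ (a * r) (r * r)) ⟩
    (r * r - a * r) + a * r  ≡⟨ cong (_+ a * r) (x∙y⁻¹≈ε⇒x≈y _ _ e) ⟩
    b + a * r                ∎

  IsRoot⇒≢0 : ¬ (b ≡ 0#) → ∀ {r} → IsRoot r → ¬ (r ≡ 0#)
  IsRoot⇒≢0 b≢0 {r} rr≡b+ar refl = b≢0 (begin
    b           ≡⟨ sym (+-identityʳ b) ⟩
    b + 0#      ≡⟨ cong (b +_) (sym (zeroʳ a)) ⟩
    b + a * 0#  ≡⟨ sym rr≡b+ar ⟩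
    0# * 0#     ≡⟨ zeroʳ 0# ⟩
    0#          ∎)

  eigenvector : Carrier → Carrier → Vec2 F
  eigenvector r α = (α * r , α)

  Q·-eigenvector : ∀ {r} → IsRoot r → ∀ α → Q· eigenvector r α ≡ eigenvector r (α * r)
  Q·-eigenvector {r} rr≡b+ar α = cong (_, α * r) (begin
    a * (α * r) + b * α  ≡⟨ +-comm _ _ ⟩
    b * α + a * (α * r)  ≡⟨ cong₂ _+_ (*-comm b α) (*.x∙yz≈y∙xz a α r) ⟩
    α * b + α * (a * r)  ≡⟨ sym (distribˡ α b (a * r)) ⟩
    α * (b + a * r)      ≡⟨ cong (α *_) (sym rr≡b+ar) ⟩
    α * (r * r)          ≡⟨ sym (*-assoc α r r) ⟩
    (α * r) * r          ∎)

  Q^-eigenvector : ∀ {r} → IsRoot r → ∀ n α → Q^ n · eigenvector r α ≡ eigenvector r (α * r ^ n)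
  Q^-eigenvector {r} _      zero    α = cong (eigenvector r) (sym (*-identityʳ α))
  Q^-eigenvector {r} isRoot (suc n) α = begin
    Q· Q^ n · eigenvector r α         ≡⟨ cong Q·_ (Q^-eigenvector isRoot n α) ⟩
    Q· eigenvector r (α * r ^ n)      ≡⟨ Q·-eigenvector isRoot (α * r ^ n) ⟩
    eigenvector r ((α * r ^ n) * r)   ≡⟨ cong (eigenvector r) (*.xy∙z≈xz∙y α (r ^ n) r) ⟩
    eigenvector r ((α * r) * r ^ n)   ≡⟨ cong (eigenvector r) (*-assoc α r (r ^ n)) ⟩
    eigenvector r (α * r ^ suc n)     ∎

  eigenvector-decomposition : ∀ {r s} → ¬ (r ≡ s) →
                              ∀ v → ∃[ α ] ∃[ β ] (v ≡ eigenvector r α ⊕ eigenvector s β)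
  eigenvector-decomposition {r} {s} r≢s (x , y) with inverse (r - s) (r≢s ∘ x∙y⁻¹≈ε⇒x≈y r s)
  ... | d , [r-s]d≡1 = α , y - α , sym (cong₂ _,_ first second)
    where
    α : Carrier
    α = (x - s * y) * d

    α[r-s]≡x-sy : α * (r - s) ≡ x - s * y
    α[r-s]≡x-sy = begin
      ((x - s * y) * d) * (r - s)  ≡⟨ *-assoc _ d (r - s) ⟩
      (x - s * y) * (d * (r - s))  ≡⟨ cong ((x - s * y) *_) (trans (*-comm d (r - s)) [r-s]d≡1) ⟩
      (x - s * y) * 1#             ≡⟨ *-identityʳ _ ⟩
      x - s * y                    ∎

    first : α * r + (y - α) * s ≡ x
    first = begin
      α * r + (y - α) * s      ≡⟨ cong (α * r +_) ([y-z]x≈yx-zx s y α) ⟩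
      α * r + (y * s - α * s)  ≡⟨ +.x∙yz≈xz∙y (α * r) (y * s) (- (α * s)) ⟩
      (α * r - α * s) + y * s  ≡⟨ cong₂ _+_ (sym (x[y-z]≈xy-xz α r s)) (*-comm y s) ⟩
      α * (r - s) + s * y      ≡⟨ cong (_+ s * y) α[r-s]≡x-sy ⟩
      (x - s * y) + s * y      ≡⟨ //-rightDividesˡ (s * y) x ⟩
      x                        ∎

    second : α + (y - α) ≡ y
    second = trans (+-comm α (y - α)) (//-rightDividesˡ α y)

  Q^|units|≡id : ¬ (b ≡ 0#) → DistinctRoots F a b → ∀ v → Q^ length units · v ≡ v
  Q^|units|≡id b≢0 (r , s , r≢s , r-root , s-root) v with eigenvector-decomposition r≢s v
  ... | α , β , refl = begin
    Q^ m · (eigenvector r α ⊕ eigenvector s β)           ≡⟨ Q^-homo-⊕ m _ _ ⟩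
    Q^ m · eigenvector r α ⊕ Q^ m · eigenvector s β      ≡⟨ cong₂ _⊕_ (period r-root α) (period s-root β) ⟩
    eigenvector r α ⊕ eigenvector s β                    ∎
    where
    m : ℕ
    m = length units

    period : ∀ {t} → t * t - a * t - b ≡ 0# → ∀ γ → Q^ m · eigenvector t γ ≡ eigenvector t γ
    period {t} t-root γ = begin
      Q^ m · eigenvector t γ     ≡⟨ Q^-eigenvector (root⇒IsRoot t-root) m γ ⟩
      eigenvector t (γ * t ^ m)  ≡⟨ cong (λ u → eigenvector t (γ * u)) (^-|units|≡1 t≢0) ⟩
      eigenvector t (γ * 1#)     ≡⟨ cong (eigenvector t) (*-identityʳ γ) ⟩
      eigenvector t γ            ∎
      where
      t≢0 : ¬ (t ≡ 0#)
      t≢0 = IsRoot⇒≢0 b≢0 (root⇒IsRoot t-root)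

  module Orbits (p : ℕ) .{{_ : NonZero p}} (Q^p≡id : ∀ v → Q^ p · v ≡ v) where

    Q^-multiple : ∀ k v → Q^ (k *ℕ p) · v ≡ v
    Q^-multiple zero    v = refl
    Q^-multiple (suc k) v = trans (Q^-homo-+ p (k *ℕ p) v) (trans (cong (Q^ p ·_) (Q^-multiple k v)) (Q^p≡id v))

    Q^-% : ∀ n v → Q^ n · v ≡ Q^ (n % p) · v
    Q^-% n v = begin
      Q^ n · v                              ≡⟨ cong (Q^_· v) (m≡m%n+[m/n]*n n p) ⟩
      Q^ (n % p +ℕ (n / p) *ℕ p) · v        ≡⟨ Q^-homo-+ (n % p) _ v ⟩
      Q^ (n % p) · Q^ ((n / p) *ℕ p) · v    ≡⟨ cong (Q^ (n % p) ·_) (Q^-multiple (n / p) v) ⟩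
      Q^ (n % p) · v                        ∎

    orbit : Vec2 F → List (Vec2 F)
    orbit v = applyUpTo (Q^_· v) p

    ∈-orbit : ∀ n v → Q^ n · v ∈ orbit v
    ∈-orbit n v = subst (_∈ orbit v) (sym (Q^-% n v)) (∈-applyUpTo⁺ (Q^_· v) (m%n<n n p))

    vectors : List (Vec2 F)
    vectors = cartesianProduct elements elements

    size*size≤1+|reps|*p : ∀ {reps} → NontrivialOrbitReps F a b reps →
                           size *ℕ size ≤ suc (length reps *ℕ p)
    size*size≤1+|reps|*p {reps} (_ , _ , covers) = subst₂ _≤_
      (length-cartesianProduct elements elements)
      (cong suc (length-concatMap orbit (λ v → length-applyUpTo _ p) reps))
      (Unique∧⊆⇒length≤ (Unique.cartesianProduct⁺ unique unique) vectors⊆)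
      where
      vectors⊆ : vectors ⊆ zeroV F ∷ concatMap orbit reps
      vectors⊆ {w} _ with ≡-dec _≟_ _≟_ w (zeroV F)
      ... | yes w≡0 = here w≡0
      ... | no w≢0 with covers w w≢0
      ...   | v , v∈reps , n , refl =
        there (∈-concatMap⁺ orbit (Any.map (λ { refl → ∈-orbit n v }) v∈reps))

mainTheorem9 : (F : FiniteField) (a b : FiniteField.Carrier F)
    → ¬ (b ≡ FiniteField.0# F)
    → DistinctRoots F a b
    → ((∃[ l ] AllOrbitsLength F a b l) ⊎ (∃[ l ] ∃[ k ] TwoOrbitLengths F a b l k))
    → (reps : List (Vec2 F))
    → NontrivialOrbitReps F a b reps
    → suc (FiniteField.size F) ≤ length reps
mainTheorem9 F a b b≢0 roots _ reps isReps =
  q*q≤1+k*m⇒1+q≤k size≡1+|units| (size*size≤1+|reps|*p isReps)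
  where
  open FiniteFieldProperties F
  open CompanionMatrix F a b
  open Orbits (length units) (Q^|units|≡id b≢0 roots)
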